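{- Let $n,d,r,k$ be positive integers with $n\geqslant \mathrm{R}\big(2d,\,r+2d-1,\,2^{k2^{2d^2+d}}\big)$. Then, for any collection $\boldsymbol{\lambda}=\big\langle\lambda_F\colon F\in\binom{\binom{[n]}{\leqslant 2}}{\leqslant d}\big\rangle$ of elements of $\mathbb{Z}_{2^k}$, there exists $X\in\binom{[n]}{r}$ such that $\boldsymbol{\lambda}$ is canonical in $X$.
   Context: $[n]=\{1,\dots,n\}$; for a finite set $A$, $\binom{A}{r}$ is the set of $r$-element subsets and $\binom{A}{\leqslant r}$ the set of nonempty subsets with at most $r$ elements; $\mathbb{Z}_{2^k}=\mathbb{Z}/2^k\mathbb{Z}$. For positive integers $\ell,m,c$ with $m\geqslant\ell$, $\mathrm{R}(\ell,m,c)$ is the least positive integer $n_0$ such that for every $n\geqslant n_0$ and every coloring $\chi\colon\binom{[n]}{\ell}\to[c]$ there is $X\in\binom{[n]}{m}$ with $\chi$ constant on $\binom{X}{\ell}$ (it exists by Ramsey's theorem). Type: for a nonempty set $F$ of nonempty subsets of $[n]$, write $\bigcup F=\{u_1<\dots<u_\ell\}$ and set $\tau(F)=\{S\subseteq[\ell]\colon\{u_i\colon i\in S\}\in F\}$. A collection $\boldsymbol{\lambda}=\langle\lambda_F\colon F\in\binom{\binom{[n]}{\leqslant 2}}{\leqslant d}\rangle$ is canonical in a nonempty $X\subseteq[n]$ if $\lambda_{F_1}=\lambda_{F_2}$ whenever $F_1,F_2\in\binom{\binom{X}{\leqslant 2}}{\leqslant d}$ satisfy $\tau(F_1)=\tau(F_2)$.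 -}

module Defs where

open import Data.Nat using (ℕ; _+_; _*_; _^_; _≤_)
open import Data.Fin using (Fin; toℕ) renaming (_≤_ to _≤ᶠ_; _<?_ to _<?ᶠ_)
open import Data.Fin.Subset using (Subset; _∈_; _⊆_; ∣_∣; _∩_; _∪_)
open import Data.Vec using (Vec; lookup; tabulate; foldr; map)
open import Data.Bool using (Bool; true; false)
open import Data.Product using (Σ; ∃; ∃-syntax; _×_; _,_)
open import Relation.Nullary.Decidable using (⌊_⌋)
open import Relation.Binary.PropositionalEquality using (_≡_)
open import Function.Bundles using (_⇔_)

Colouring : ℕ → ℕ → ℕ → Set
Colouring n ℓ c = (s : Subset n) → ∣ s ∣ ≡ ℓ → Fin c

MonochromaticIn : ∀ {n ℓ c} → Colouring n ℓ c → Subset n → Set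
MonochromaticIn {n} {ℓ} χ X =
  (A B : Subset n) (pA : ∣ A ∣ ≡ ℓ) (pB : ∣ B ∣ ≡ ℓ) →
  A ⊆ X → B ⊆ X → χ A pA ≡ χ B pB

RamseyBound : ℕ → ℕ → ℕ → ℕ → Set
RamseyBound ℓ m c n₀ =
  (n : ℕ) → n₀ ≤ n → (χ : Colouring n ℓ c) →
  ∃[ X ] (∣ X ∣ ≡ m × MonochromaticIn χ X)

IsRamseyNumber : ℕ → ℕ → ℕ → ℕ → Set
IsRamseyNumber ℓ m c n₀ =
  1 ≤ n₀ × RamseyBound ℓ m c n₀ ×
  ((n₁ : ℕ) → 1 ≤ n₁ → RamseyBound ℓ m c n₁ → n₀ ≤ n₁)

-- Families of sets of size ≤ 2.
-- An element of binom([n], ≤2) is {i,j} with i ≤ j (i = j giving the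
-- singleton {i}); we encode it as the ordered pair (i , j) with i ≤ j.
-- A set F of such elements is encoded by its "adjacency" table:
-- (i , j) ∈ F  iff  j ∈ lookup F i.

Fam : ℕ → Set
Fam n = Vec (Subset n) n

_∈F_ : ∀ {n} → Fin n × Fin n → Fam n → Set
(i , j) ∈F F = j ∈ lookup F i

WellFormed : ∀ {n} → Fam n → Set
WellFormed {n} F = (i j : Fin n) → (i , j) ∈F F → i ≤ᶠ j

size : ∀ {n} → Fam n → ℕ
size F = foldr (λ _ → ℕ) (λ s acc → ∣ s ∣ + acc) 0 F

IsFamily : ∀ {n} → ℕ → Fam n → Set
IsFamily d F = WellFormed F × 1 ≤ size F × size F ≤ d

FamIn : ∀ {n} → Fam n → Subset n → Set
FamIn {n} F X = (i j : Fin n) → (i , j) ∈F F → i ∈ X × j ∈ X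

⋃F : ∀ {n} → Fam n → Subset n
⋃F {n} F = tabulate λ u →
  foldr (λ _ → Bool) Data.Bool._∨_ false
    (tabulate λ v → (lookup (lookup F u) v) Data.Bool.∨ (lookup (lookup F v) u))
  where import Data.Bool

-- rank of u in U = {u₁ < … < u_ℓ}: number of elements of U below u
-- (so u_i has rank i - 1; ranks are 0-based)
rank : ∀ {n} → Subset n → Fin n → ℕ
rank U u = ∣ U ∩ tabulate (λ v → ⌊ v <?ᶠ u ⌋) ∣

-- {a,b} (0-based ranks, a ≤ b; a = b for a singleton) belongs to τ(F)
InType : ∀ {n} → Fam n → ℕ → ℕ → Set
InType {n} F a b = Σ (Fin n) λ i → Σ (Fin n) λ j →
  (i , j) ∈F F × rank (⋃F F) i ≡ a × rank (⋃F F) j ≡ b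

SameType : ∀ {n} → Fam n → Fam n → Set
SameType F₁ F₂ = (a b : ℕ) → InType F₁ a b ⇔ InType F₂ a b

Canonical : ∀ {n} → ℕ → {A : Set} → (Fam n → A) → Subset n → Set
Canonical {n} d λ' X = (F₁ F₂ : Fam n) →
  IsFamily d F₁ → IsFamily d F₂ → FamIn F₁ X → FamIn F₂ X →
  SameType F₁ F₂ → λ' F₁ ≡ λ' F₂

-- Encode a family on a 2d-set Y by the bit pattern of its type: bit number
-- pairIndex a b = b(b+1)/2 + a records whether {y_a , y_b} is a member, so
-- there are 2d²+d bits.  Colour every 2d-subset Y of [n] by the whole table
-- "pattern ↦ λ(family on Y with that pattern)", an element of
-- (2^k)^(2^(2d²+d)) = 2^(k·2^(2d²+d)) colours, and take a monochromatic X of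
-- size r+2d-1.  Every family F inside the first r elements of X, having at most
-- 2d vertices, sits as an initial segment in some 2d-subset Y ⊆ X, and it is
-- the family on Y with its own type pattern.  Hence families of equal type
-- inside the first r elements of X are read off the same table with the same
-- pattern, and receive the same value of λ.

module Submission where

open import Defs
open import Data.Nat using (ℕ; zero; suc; _+_; _*_; _^_; _≤_; _<_; _∸_; z≤n; s≤s)
open import Data.Nat.Properties
open import Data.Nat.Tactic.RingSolver using (solve-∀)
open import Data.Fin as Fin
  using (Fin; toℕ; fromℕ<; cast; funToFin; finToFun)
  renaming (_≤_ to _≤ᶠ_; _<_ to _<ᶠ_; _≤?_ to _≤ᶠ?_)
open import Data.Fin.Properties as Finₚ
  using (2↔Bool; finToFun-funToFin; toℕ-fromℕ<; toℕ-cast; toℕ-injective; any?)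
open import Data.Fin.Subset
  using (Subset; _∈_; _∉_; _⊆_; ∣_∣; _∩_; _∪_; ⊥; Empty)
open import Data.Fin.Subset.Properties
open import Data.Vec using (Vec; []; _∷_; lookup; tabulate; foldr; here; there)
open import Data.Vec.Properties using (lookup∘tabulate; []=⇒lookup; lookup⇒[]=)
open import Data.Vec.Relation.Binary.Pointwise.Extensional using (ext; Pointwise-≡⇒≡)
open import Data.Bool using (Bool; true; false; _∨_; T)
open import Data.Bool.Properties using (∨-zeroʳ)
open import Data.Product using (∃; ∃₂; ∃-syntax; _×_; _,_; proj₁; proj₂)
open import Data.Sum using (_⊎_; inj₁; inj₂)
open import Data.Empty using (⊥-elim)
open import Function using (_∘_)
open import Function.Bundles using (Inverse; Equivalence; mk⇔)
open import Relation.Binary using (tri<; tri≈; tri>)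
open import Relation.Binary.PropositionalEquality
open import Relation.Nullary using (Dec; yes; no; does; contradiction)
open import Relation.Nullary.Decidable
  using (⌊_⌋; _×-dec_; T?; isYes≗does; does-⇔; toWitness; fromWitness)

private
  variable
    n m : ℕ

∣p∪q∣+∣p∩q∣≡∣p∣+∣q∣ : (p q : Subset n) → ∣ p ∪ q ∣ + ∣ p ∩ q ∣ ≡ ∣ p ∣ + ∣ q ∣
∣p∪q∣+∣p∩q∣≡∣p∣+∣q∣ [] [] = refl
∣p∪q∣+∣p∩q∣≡∣p∣+∣q∣ (true ∷ p) (true ∷ q) = cong suc (begin
  ∣ p ∪ q ∣ + suc ∣ p ∩ q ∣  ≡⟨ +-suc _ _ ⟩
  suc (∣ p ∪ q ∣ + ∣ p ∩ q ∣) ≡⟨ cong suc (∣p∪q∣+∣p∩q∣≡∣p∣+∣q∣ p q) ⟩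
  suc (∣ p ∣ + ∣ q ∣)         ≡⟨ +-suc _ _ ⟨
  ∣ p ∣ + suc ∣ q ∣           ∎)
  where open ≡-Reasoning
∣p∪q∣+∣p∩q∣≡∣p∣+∣q∣ (true ∷ p) (false ∷ q) = cong suc (∣p∪q∣+∣p∩q∣≡∣p∣+∣q∣ p q)
∣p∪q∣+∣p∩q∣≡∣p∣+∣q∣ (false ∷ p) (true ∷ q) =
  trans (cong suc (∣p∪q∣+∣p∩q∣≡∣p∣+∣q∣ p q)) (sym (+-suc _ _))
∣p∪q∣+∣p∩q∣≡∣p∣+∣q∣ (false ∷ p) (false ∷ q) = ∣p∪q∣+∣p∩q∣≡∣p∣+∣q∣ p q

∣p∪q∣≤∣p∣+∣q∣ : (p q : Subset n) → ∣ p ∪ q ∣ ≤ ∣ p ∣ + ∣ q ∣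
∣p∪q∣≤∣p∣+∣q∣ p q = m+n≤o⇒m≤o _ (≤-reflexive (∣p∪q∣+∣p∩q∣≡∣p∣+∣q∣ p q))

Empty⇒∣p∣≡0 : {p : Subset n} → Empty p → ∣ p ∣ ≡ 0
Empty⇒∣p∣≡0 {n} empty = trans (cong ∣_∣ (Empty-unique empty)) (∣⊥∣≡0 n)

∣p∪q∣≡∣p∣+∣q∣ : (p q : Subset n) → Empty (p ∩ q) → ∣ p ∪ q ∣ ≡ ∣ p ∣ + ∣ q ∣
∣p∪q∣≡∣p∣+∣q∣ p q disjoint = begin
  ∣ p ∪ q ∣             ≡⟨ +-identityʳ _ ⟨
  ∣ p ∪ q ∣ + 0         ≡⟨ cong (∣ p ∪ q ∣ +_) (Empty⇒∣p∣≡0 disjoint) ⟨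
  ∣ p ∪ q ∣ + ∣ p ∩ q ∣ ≡⟨ ∣p∪q∣+∣p∩q∣≡∣p∣+∣q∣ p q ⟩
  ∣ p ∣ + ∣ q ∣         ∎
  where open ≡-Reasoning

x∈p⇒1≤∣p∣ : {x : Fin n} {p : Subset n} → x ∈ p → 1 ≤ ∣ p ∣
x∈p⇒1≤∣p∣ x∈p = m<n⇒0<n (x∈p⇒∣p-x∣<∣p∣ x∈p)

-- ⌊_⌋ rather than does, so that below u is literally the set counted by rank
select : {P : Fin n → Set} → (∀ x → Dec (P x)) → Subset n
select P? = tabulate λ x → ⌊ P? x ⌋

∈-select⁺ : {P : Fin n → Set} (P? : ∀ x → Dec (P x)) {x : Fin n} → P x → x ∈ select P?
∈-select⁺ P? {x} px with P? x | lookup∘tabulate (λ x → ⌊ P? x ⌋) x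
... | yes _   | lookup≡true = lookup⇒[]= x _ lookup≡true
... | no ¬px | _ = contradiction px ¬px

∈-select⁻ : {P : Fin n → Set} (P? : ∀ x → Dec (P x)) {x : Fin n} → x ∈ select P? → P x
∈-select⁻ P? {x} x∈ with P? x | trans (sym (lookup∘tabulate (λ x → ⌊ P? x ⌋) x)) ([]=⇒lookup x∈)
... | yes px | _ = px
... | no _   | ()

below : Fin n → Subset n
below u = select (Fin._<? u)

∈below⁺ : {u v : Fin n} → v <ᶠ u → v ∈ below u
∈below⁺ {u = u} = ∈-select⁺ (Fin._<? u)

∈below⁻ : {u v : Fin n} → v ∈ below u → v <ᶠ u
∈below⁻ {u = u} = ∈-select⁻ (Fin._<? u)

below-mono : (S : Subset n) {i j : Fin n} → i ≤ᶠ j → S ∩ below i ⊆ S ∩ below j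
below-mono S i≤j v∈ = let v∈S , v<i = x∈p∩q⁻ S _ v∈ in
  x∈p∩q⁺ (v∈S , ∈below⁺ (<-≤-trans (∈below⁻ v<i) i≤j))

i∉S∩below[i] : (S : Subset n) {i : Fin n} → i ∉ S ∩ below i
i∉S∩below[i] S i∈ = <-irrefl refl (∈below⁻ (proj₂ (x∈p∩q⁻ S _ i∈)))

rank-mono : (S : Subset n) {i j : Fin n} → i ≤ᶠ j → rank S i ≤ rank S j
rank-mono S i≤j = p⊆q⇒∣p∣≤∣q∣ (below-mono S i≤j)

rank<∣S∣ : (S : Subset n) {i : Fin n} → i ∈ S → rank S i < ∣ S ∣
rank<∣S∣ S {i} i∈S = p⊂q⇒∣p∣<∣q∣ (p∩q⊆p S (below i) , i , i∈S , i∉S∩below[i] S)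

rank-strict : (S : Subset n) {i j : Fin n} → i <ᶠ j → i ∈ S → rank S i < rank S j
rank-strict S i<j i∈S = p⊂q⇒∣p∣<∣q∣
  (below-mono S (<⇒≤ i<j) , _ , x∈p∩q⁺ (i∈S , ∈below⁺ i<j) , i∉S∩below[i] S)

rank-injective : (S : Subset n) {i j : Fin n} → i ∈ S → j ∈ S → rank S i ≡ rank S j → i ≡ j
rank-injective S {i} {j} i∈S j∈S eq with Finₚ.<-cmp i j
... | tri< i<j _ _ = contradiction eq (<⇒≢ (rank-strict S i<j i∈S))
... | tri≈ _ i≡j _ = i≡j
... | tri> _ _ j<i = contradiction (sym eq) (<⇒≢ (rank-strict S j<i j∈S))

IsInitialSegment : Subset n → Subset n → Set
IsInitialSegment U Y = U ⊆ Y × (∀ {u y} → u ∈ U → y ∈ Y → y ∉ U → u <ᶠ y)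

rank-initialSegment : {U Y : Subset n} → IsInitialSegment U Y →
  ∀ {u} → u ∈ U → rank Y u ≡ rank U u
rank-initialSegment {U = U} {Y} (U⊆Y , U<rest) {u} u∈U =
  cong ∣_∣ (⊆-antisym Y-below⊆U-below U-below⊆Y-below)
  where
  U-below⊆Y-below : U ∩ below u ⊆ Y ∩ below u
  U-below⊆Y-below v∈ = let v∈U , v<u = x∈p∩q⁻ U _ v∈ in x∈p∩q⁺ (U⊆Y v∈U , v<u)
  Y-below⊆U-below : Y ∩ below u ⊆ U ∩ below u
  Y-below⊆U-below {v} v∈ with x∈p∩q⁻ Y _ v∈ | v ∈? U
  ... | _ , v<u | yes v∈U = x∈p∩q⁺ (v∈U , v<u)
  ... | v∈Y , v<u | no v∉U = contradiction (∈below⁻ v<u) (<-asym (U<rest u∈U v∈Y v∉U))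

takeFirst : ℕ → Subset n → Subset n
takeFirst j [] = []
takeFirst j (false ∷ s) = false ∷ takeFirst j s
takeFirst zero (true ∷ s) = false ∷ takeFirst zero s
takeFirst (suc j) (true ∷ s) = true ∷ takeFirst j s

dropFirst : ℕ → Subset n → Subset n
dropFirst j [] = []
dropFirst j (false ∷ s) = false ∷ dropFirst j s
dropFirst zero (true ∷ s) = true ∷ dropFirst zero s
dropFirst (suc j) (true ∷ s) = false ∷ dropFirst j s

∣takeFirst∣ : ∀ j (s : Subset n) → j ≤ ∣ s ∣ → ∣ takeFirst j s ∣ ≡ j
∣takeFirst∣ zero [] _ = refl
∣takeFirst∣ j (false ∷ s) j≤ = ∣takeFirst∣ j s j≤
∣takeFirst∣ zero (true ∷ s) _ = ∣takeFirst∣ zero s z≤n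
∣takeFirst∣ (suc j) (true ∷ s) (s≤s j≤) = cong suc (∣takeFirst∣ j s j≤)

∣dropFirst∣ : ∀ j (s : Subset n) → ∣ dropFirst j s ∣ ≡ ∣ s ∣ ∸ j
∣dropFirst∣ zero [] = refl
∣dropFirst∣ (suc j) [] = refl
∣dropFirst∣ j (false ∷ s) = ∣dropFirst∣ j s
∣dropFirst∣ zero (true ∷ s) = cong suc (∣dropFirst∣ zero s)
∣dropFirst∣ (suc j) (true ∷ s) = ∣dropFirst∣ j s

takeFirst⊆ : ∀ j (s : Subset n) → takeFirst j s ⊆ s
takeFirst⊆ j (false ∷ s) (there x∈) = there (takeFirst⊆ j s x∈)
takeFirst⊆ zero (true ∷ s) (there x∈) = there (takeFirst⊆ zero s x∈)
takeFirst⊆ (suc j) (true ∷ s) here = here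
takeFirst⊆ (suc j) (true ∷ s) (there x∈) = there (takeFirst⊆ j s x∈)

dropFirst⊆ : ∀ j (s : Subset n) → dropFirst j s ⊆ s
dropFirst⊆ j (false ∷ s) (there x∈) = there (dropFirst⊆ j s x∈)
dropFirst⊆ zero (true ∷ s) here = here
dropFirst⊆ zero (true ∷ s) (there x∈) = there (dropFirst⊆ zero s x∈)
dropFirst⊆ (suc j) (true ∷ s) (there x∈) = there (dropFirst⊆ j s x∈)

takeFirst-zero-empty : (s : Subset n) → Empty (takeFirst zero s)
takeFirst-zero-empty (false ∷ s) (_ , there x∈) = takeFirst-zero-empty s (_ , x∈)
takeFirst-zero-empty (true ∷ s) (_ , there x∈) = takeFirst-zero-empty s (_ , x∈)

takeFirst<dropFirst : ∀ j (s : Subset n) {x y : Fin n} →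
  x ∈ takeFirst j s → y ∈ dropFirst j s → x <ᶠ y
takeFirst<dropFirst j (false ∷ s) (there x∈) (there y∈) = s≤s (takeFirst<dropFirst j s x∈ y∈)
takeFirst<dropFirst zero (true ∷ s) (there x∈) _ = ⊥-elim (takeFirst-zero-empty s (_ , x∈))
takeFirst<dropFirst (suc j) (true ∷ s) here (there _) = s≤s z≤n
takeFirst<dropFirst (suc j) (true ∷ s) (there x∈) (there y∈) = s≤s (takeFirst<dropFirst j s x∈ y∈)

extend-initialSegment : (r m : ℕ) {U X : Subset n} → U ⊆ takeFirst r X →
  ∣ U ∣ ≤ m → m ∸ ∣ U ∣ ≤ ∣ X ∣ ∸ r →
  ∃ λ Y → ∣ Y ∣ ≡ m × Y ⊆ X × IsInitialSegment U Y
extend-initialSegment r m {U} {X} U⊆ ∣U∣≤m room =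
  U ∪ V , ∣U∪V∣≡m , U∪V⊆X , p⊆p∪q V , U<V
  where
  V = takeFirst (m ∸ ∣ U ∣) (dropFirst r X)
  V⊆rest : V ⊆ dropFirst r X
  V⊆rest = takeFirst⊆ _ (dropFirst r X)
  ∣V∣ : ∣ V ∣ ≡ m ∸ ∣ U ∣
  ∣V∣ = ∣takeFirst∣ _ (dropFirst r X) (subst (m ∸ ∣ U ∣ ≤_) (sym (∣dropFirst∣ r X)) room)
  disjoint : Empty (U ∩ V)
  disjoint (_ , x∈) = let x∈U , x∈V = x∈p∩q⁻ U V x∈ in
    <-irrefl refl (takeFirst<dropFirst r X (U⊆ x∈U) (V⊆rest x∈V))
  ∣U∪V∣≡m : ∣ U ∪ V ∣ ≡ m
  ∣U∪V∣≡m = trans (∣p∪q∣≡∣p∣+∣q∣ U V disjoint) (trans (cong (∣ U ∣ +_) ∣V∣) (m+[n∸m]≡n ∣U∣≤m))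
  U∪V⊆X : U ∪ V ⊆ X
  U∪V⊆X x∈ with x∈p∪q⁻ U V x∈
  ... | inj₁ x∈U = takeFirst⊆ r X (U⊆ x∈U)
  ... | inj₂ x∈V = dropFirst⊆ r X (V⊆rest x∈V)
  U<V : ∀ {u y} → u ∈ U → y ∈ U ∪ V → y ∉ U → u <ᶠ y
  U<V u∈U y∈ y∉U with x∈p∪q⁻ U V y∈
  ... | inj₁ y∈U = contradiction y∈U y∉U
  ... | inj₂ y∈V = takeFirst<dropFirst r X (U⊆ u∈U) (V⊆rest y∈V)

foldr-∨-tabulate⁺ : (g : Fin m → Bool) (v : Fin m) → g v ≡ true →
  foldr (λ _ → Bool) _∨_ false (tabulate g) ≡ true
foldr-∨-tabulate⁺ g Fin.zero gv rewrite gv = refl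
foldr-∨-tabulate⁺ g (Fin.suc v) gv with g Fin.zero
... | true = refl
... | false = foldr-∨-tabulate⁺ (g ∘ Fin.suc) v gv

foldr-∨-tabulate⁻ : (g : Fin m → Bool) → foldr (λ _ → Bool) _∨_ false (tabulate g) ≡ true →
  ∃ λ v → g v ≡ true
foldr-∨-tabulate⁻ {suc m} g any with g Fin.zero in g0
... | true = Fin.zero , g0
... | false = let v , gv = foldr-∨-tabulate⁻ (g ∘ Fin.suc) any in Fin.suc v , gv

∈⋃F⁻ : (F : Fam n) {u : Fin n} → u ∈ ⋃F F → ∃ λ v → (u , v) ∈F F ⊎ (v , u) ∈F F
∈⋃F⁻ F {u} u∈ with foldr-∨-tabulate⁻ _ (trans (sym (lookup∘tabulate _ u)) ([]=⇒lookup u∈))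
... | v , uv∨vu with lookup (lookup F u) v in uv
... | true = v , inj₁ (lookup⇒[]= v _ uv)
... | false = v , inj₂ (lookup⇒[]= u _ uv∨vu)

∈⋃F⁺ˡ : (F : Fam n) {i j : Fin n} → (i , j) ∈F F → i ∈ ⋃F F
∈⋃F⁺ˡ F {i} {j} ij∈ = lookup⇒[]= i _ (trans (lookup∘tabulate _ i)
  (foldr-∨-tabulate⁺ _ j (cong (_∨ lookup (lookup F j) i) ([]=⇒lookup ij∈))))

∈⋃F⁺ʳ : (F : Fam n) {i j : Fin n} → (i , j) ∈F F → j ∈ ⋃F F
∈⋃F⁺ʳ F {i} {j} ij∈ = lookup⇒[]= j _ (trans (lookup∘tabulate _ j)
  (foldr-∨-tabulate⁺ _ i (trans (cong (lookup (lookup F j) i ∨_) ([]=⇒lookup ij∈)) (∨-zeroʳ _))))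

⋃F⊆ : {F : Fam n} {X : Subset n} → FamIn F X → ⋃F F ⊆ X
⋃F⊆ {F = F} F-in-X u∈ with ∈⋃F⁻ F u∈
... | _ , inj₁ uv∈ = proj₁ (F-in-X _ _ uv∈)
... | _ , inj₂ vu∈ = proj₂ (F-in-X _ _ vu∈)

totalSize : Vec (Subset n) m → ℕ
totalSize = foldr (λ _ → ℕ) (λ s acc → ∣ s ∣ + acc) 0

sources : Vec (Subset n) m → Subset m
sources [] = []
sources (s ∷ V) = ⌊ 1 ≤? ∣ s ∣ ⌋ ∷ sources V

targets : Vec (Subset n) m → Subset n
targets [] = ⊥
targets (s ∷ V) = s ∪ targets V

∣sources∣≤totalSize : (V : Vec (Subset n) m) → ∣ sources V ∣ ≤ totalSize V
∣sources∣≤totalSize [] = z≤n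
∣sources∣≤totalSize (s ∷ V) with 1 ≤? ∣ s ∣
... | yes 1≤∣s∣ = +-mono-≤ 1≤∣s∣ (∣sources∣≤totalSize V)
... | no _ = ≤-trans (∣sources∣≤totalSize V) (m≤n+m _ _)

∣targets∣≤totalSize : (V : Vec (Subset n) m) → ∣ targets V ∣ ≤ totalSize V
∣targets∣≤totalSize {n} [] = ≤-reflexive (∣⊥∣≡0 n)
∣targets∣≤totalSize (s ∷ V) =
  ≤-trans (∣p∪q∣≤∣p∣+∣q∣ s (targets V)) (+-monoʳ-≤ ∣ s ∣ (∣targets∣≤totalSize V))

∈sources : (V : Vec (Subset n) m) (i : Fin m) {j : Fin n} → j ∈ lookup V i → i ∈ sources V
∈sources (s ∷ V) Fin.zero j∈ with 1 ≤? ∣ s ∣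
... | yes _ = here
... | no 1≰∣s∣ = contradiction (x∈p⇒1≤∣p∣ j∈) 1≰∣s∣
∈sources (s ∷ V) (Fin.suc i) j∈ = there (∈sources V i j∈)

∈targets : (V : Vec (Subset n) m) (i : Fin m) {j : Fin n} → j ∈ lookup V i → j ∈ targets V
∈targets (s ∷ V) Fin.zero j∈ = p⊆p∪q (targets V) j∈
∈targets (s ∷ V) (Fin.suc i) j∈ = q⊆p∪q s (targets V) (∈targets V i j∈)

∣⋃F∣≤2*size : (F : Fam n) → ∣ ⋃F F ∣ ≤ 2 * size F
∣⋃F∣≤2*size F = begin
  ∣ ⋃F F ∣                          ≤⟨ p⊆q⇒∣p∣≤∣q∣ ⋃F⊆sources∪targets ⟩
  ∣ sources F ∪ targets F ∣         ≤⟨ ∣p∪q∣≤∣p∣+∣q∣ (sources F) (targets F) ⟩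
  ∣ sources F ∣ + ∣ targets F ∣     ≤⟨ +-mono-≤ (∣sources∣≤totalSize F) (∣targets∣≤totalSize F) ⟩
  size F + size F                   ≡⟨ cong (size F +_) (+-identityʳ _) ⟨
  2 * size F                        ∎
  where
  open ≤-Reasoning
  ⋃F⊆sources∪targets : ⋃F F ⊆ sources F ∪ targets F
  ⋃F⊆sources∪targets u∈ with ∈⋃F⁻ F u∈
  ... | v , inj₁ uv∈ = p⊆p∪q (targets F) (∈sources F _ uv∈)
  ... | v , inj₂ vu∈ = q⊆p∪q (sources F) (targets F) (∈targets F v vu∈)

1≤totalSize⇒member : (V : Vec (Subset n) m) → 1 ≤ totalSize V → ∃₂ λ i j → j ∈ lookup V i
1≤totalSize⇒member (s ∷ V) 1≤size with nonempty? s
... | yes (j , j∈s) = Fin.zero , j , j∈s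
... | no s-empty =
  let i , j , j∈ = 1≤totalSize⇒member V (subst (λ c → 1 ≤ c + totalSize V) (Empty⇒∣p∣≡0 s-empty) 1≤size)
  in Fin.suc i , j , j∈

1≤∣⋃F∣ : (F : Fam n) → 1 ≤ size F → 1 ≤ ∣ ⋃F F ∣
1≤∣⋃F∣ F 1≤size = let _ , _ , ij∈ = 1≤totalSize⇒member F 1≤size in x∈p⇒1≤∣p∣ (∈⋃F⁺ˡ F ij∈)

triangle : ℕ → ℕ
triangle zero = 0
triangle (suc b) = triangle b + suc b

pairIndex : ℕ → ℕ → ℕ
pairIndex a b = triangle b + a

triangle-mono-≤ : {b c : ℕ} → b ≤ c → triangle b ≤ triangle c
triangle-mono-≤ {c = zero} z≤n = ≤-refl
triangle-mono-≤ {c = suc c} b≤1+c with m≤n⇒m<n∨m≡n b≤1+c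
... | inj₁ (s≤s b≤c) = ≤-trans (triangle-mono-≤ b≤c) (m≤m+n _ _)
... | inj₂ refl = ≤-refl

pairIndex<triangle[1+b] : {a b : ℕ} → a ≤ b → pairIndex a b < triangle (suc b)
pairIndex<triangle[1+b] {b = b} a≤b = +-monoʳ-< (triangle b) (s≤s a≤b)

pairIndex<triangle : {a b c : ℕ} → a ≤ b → b < c → pairIndex a b < triangle c
pairIndex<triangle a≤b b<c = <-≤-trans (pairIndex<triangle[1+b] a≤b) (triangle-mono-≤ b<c)

pairIndex-injective : {a b a′ b′ : ℕ} → a ≤ b → a′ ≤ b′ →
  pairIndex a b ≡ pairIndex a′ b′ → a ≡ a′ × b ≡ b′
pairIndex-injective {a} {b} {a′} {b′} a≤b a′≤b′ eq with <-cmp b b′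
... | tri< b<b′ _ _ = contradiction eq (<⇒≢ (<-≤-trans (pairIndex<triangle a≤b b<b′) (m≤m+n _ a′)))
... | tri> _ _ b′<b = contradiction (sym eq) (<⇒≢ (<-≤-trans (pairIndex<triangle a′≤b′ b′<b) (m≤m+n _ a)))
... | tri≈ _ refl _ = +-cancelˡ-≡ (triangle b) a a′ eq , refl

triangle[2d] : ∀ d → triangle (2 * d) ≡ 2 * d * d + d
triangle[2d] zero = refl
triangle[2d] (suc d) = begin
  triangle (2 * suc d)                               ≡⟨ cong triangle (*-suc 2 d) ⟩
  triangle (2 * d) + suc (2 * d) + suc (suc (2 * d))
    ≡⟨ cong (λ t → t + suc (2 * d) + suc (suc (2 * d))) (triangle[2d] d) ⟩
  2 * d * d + d + suc (2 * d) + suc (suc (2 * d))    ≡⟨ expand d ⟩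
  2 * suc d * suc d + suc d                          ∎
  where
  open ≡-Reasoning
  expand : ∀ d → 2 * d * d + d + suc (2 * d) + suc (suc (2 * d)) ≡ 2 * suc d * suc d + suc d
  expand = solve-∀

Fam-ext : {F G : Fam n} → (∀ i j → (i , j) ∈F F → (i , j) ∈F G) →
  (∀ i j → (i , j) ∈F G → (i , j) ∈F F) → F ≡ G
Fam-ext F⊆G G⊆F = Pointwise-≡⇒≡ (ext λ i → ⊆-antisym (F⊆G i _) (G⊆F i _))

InDecoding : Subset n → (ℕ → Bool) → Fin n → Fin n → Set
InDecoding Y β i j = i ∈ Y × j ∈ Y × i ≤ᶠ j × T (β (pairIndex (rank Y i) (rank Y j)))

decodeFamily : Subset n → (ℕ → Bool) → Fam n
decodeFamily Y β = tabulate λ i → select λ j →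
  (i ∈? Y) ×-dec (j ∈? Y) ×-dec (i ≤ᶠ? j) ×-dec T? (β (pairIndex (rank Y i) (rank Y j)))

∈decodeFamily⁺ : {Y : Subset n} {β : ℕ → Bool} {i j : Fin n} →
  InDecoding Y β i j → (i , j) ∈F decodeFamily Y β
∈decodeFamily⁺ {i = i} {j} in-decoding =
  subst (j ∈_) (sym (lookup∘tabulate _ i)) (∈-select⁺ _ in-decoding)

∈decodeFamily⁻ : {Y : Subset n} {β : ℕ → Bool} {i j : Fin n} →
  (i , j) ∈F decodeFamily Y β → InDecoding Y β i j
∈decodeFamily⁻ {i = i} {j} ij∈ = ∈-select⁻ _ (subst (j ∈_) (lookup∘tabulate _ i) ij∈)

decodeFamily-cong : (Y : Subset n) {β γ : ℕ → Bool} →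
  (∀ {p} → p < triangle ∣ Y ∣ → β p ≡ γ p) → decodeFamily Y β ≡ decodeFamily Y γ
decodeFamily-cong Y β≈γ = Fam-ext (transfer β≈γ) (transfer (sym ∘ β≈γ))
  where
  transfer : {β γ : ℕ → Bool} → (∀ {p} → p < triangle ∣ Y ∣ → β p ≡ γ p) →
    ∀ i j → (i , j) ∈F decodeFamily Y β → (i , j) ∈F decodeFamily Y γ
  transfer {β} {γ} β≈γ i j ij∈ with ∈decodeFamily⁻ {Y = Y} {β} ij∈
  ... | i∈Y , j∈Y , i≤j , bit = ∈decodeFamily⁺ {Y = Y} {γ} (i∈Y , j∈Y , i≤j ,
    subst T (β≈γ (pairIndex<triangle (rank-mono Y i≤j) (rank<∣S∣ Y j∈Y))) bit)

IndexesType : Fam n → ℕ → Set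
IndexesType F p = ∃₂ λ i j → (i , j) ∈F F × pairIndex (rank (⋃F F) i) (rank (⋃F F) j) ≡ p

indexesType? : (F : Fam n) (p : ℕ) → Dec (IndexesType F p)
indexesType? F p = any? λ i → any? λ j →
  (j ∈? lookup F i) ×-dec (pairIndex (rank (⋃F F) i) (rank (⋃F F) j) ≟ p)

typePattern : Fam n → ℕ → Bool
typePattern F p = ⌊ indexesType? F p ⌋

indexesType-transport : {F G : Fam n} → (∀ a b → InType F a b → InType G a b) →
  ∀ {p} → IndexesType F p → IndexesType G p
indexesType-transport F⊆G (i , j , ij∈ , eq) =
  let i′ , j′ , ij∈′ , rank-i′ , rank-j′ = F⊆G _ _ (i , j , ij∈ , refl , refl)
  in i′ , j′ , ij∈′ , trans (cong₂ pairIndex rank-i′ rank-j′) eq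

sameType⇒typePattern : {F G : Fam n} → SameType F G → ∀ p → typePattern F p ≡ typePattern G p
sameType⇒typePattern {F = F} {G} same p = begin
  ⌊ indexesType? F p ⌋      ≡⟨ isYes≗does _ ⟩
  does (indexesType? F p)   ≡⟨ does-⇔ F⇔G (indexesType? F p) (indexesType? G p) ⟩
  does (indexesType? G p)   ≡⟨ isYes≗does _ ⟨
  ⌊ indexesType? G p ⌋      ∎
  where
  open ≡-Reasoning
  F⇔G = mk⇔ (indexesType-transport {F = F} {G} (λ a b → Equivalence.to (same a b)))
            (indexesType-transport {F = G} {F} (λ a b → Equivalence.from (same a b)))

-- Ranks in Y and in ⋃F agree on ⋃F, so reading the type pattern of F on Y recovers F.
decodeFamily-typePattern : {F : Fam n} {Y : Subset n} → WellFormed F →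
  IsInitialSegment (⋃F F) Y → decodeFamily Y (typePattern F) ≡ F
decodeFamily-typePattern {F = F} {Y} wf initial@(U⊆Y , _) = Fam-ext decoded⊆F F⊆decoded
  where
  U = ⋃F F
  rank≡ : ∀ {u} → u ∈ U → rank Y u ≡ rank U u
  rank≡ = rank-initialSegment initial
  F⊆decoded : ∀ i j → (i , j) ∈F F → (i , j) ∈F decodeFamily Y (typePattern F)
  F⊆decoded i j ij∈ = ∈decodeFamily⁺ {Y = Y} {typePattern F} (U⊆Y i∈U , U⊆Y j∈U , wf i j ij∈ ,
    fromWitness {a? = indexesType? F _} (i , j , ij∈ , cong₂ pairIndex (sym (rank≡ i∈U)) (sym (rank≡ j∈U))))
    where
    i∈U = ∈⋃F⁺ˡ F ij∈
    j∈U = ∈⋃F⁺ʳ F ij∈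
  decoded⊆F : ∀ i j → (i , j) ∈F decodeFamily Y (typePattern F) → (i , j) ∈F F
  decoded⊆F i j ij∈ with ∈decodeFamily⁻ {Y = Y} {typePattern F} ij∈
  ... | i∈Y , j∈Y , i≤j , bit
    with toWitness {a? = indexesType? F (pairIndex (rank Y i) (rank Y j))} bit
  ... | i′ , j′ , ij∈′ , eq = subst₂ (λ a b → (a , b) ∈F F) i′≡i j′≡j ij∈′
    where
    i′∈U = ∈⋃F⁺ˡ F ij∈′
    j′∈U = ∈⋃F⁺ʳ F ij∈′
    ranks = pairIndex-injective (rank-mono U (wf i′ j′ ij∈′)) (rank-mono Y i≤j) eq
    i′≡i = rank-injective Y (U⊆Y i′∈U) i∈Y (trans (rank≡ i′∈U) (proj₁ ranks))
    j′≡j = rank-injective Y (U⊆Y j′∈U) j∈Y (trans (rank≡ j′∈U) (proj₂ ranks))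

IsDecodingSet : ℕ → Subset n → Fam n → Subset n → Set
IsDecodingSet d X F Y = ∣ Y ∣ ≡ 2 * d × Y ⊆ X × decodeFamily Y (typePattern F) ≡ F

decodingSet : {d r : ℕ} {X : Subset n} {F : Fam n} → ∣ X ∣ ≡ r + 2 * d ∸ 1 →
  IsFamily d F → FamIn F (takeFirst r X) → ∃ (IsDecodingSet d X F)
decodingSet {d = d} {r} {X} {F} ∣X∣ (wf , 1≤size , size≤d) F-in =
  let Y , ∣Y∣ , Y⊆X , initial = extend-initialSegment r (2 * d) (⋃F⊆ {F = F} F-in) ∣⋃F∣≤2d room
  in Y , ∣Y∣ , Y⊆X , decodeFamily-typePattern {F = F} {Y} wf initial
  where
  ∣⋃F∣≤2d : ∣ ⋃F F ∣ ≤ 2 * d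
  ∣⋃F∣≤2d = ≤-trans (∣⋃F∣≤2*size F) (*-monoʳ-≤ 2 size≤d)
  room : 2 * d ∸ ∣ ⋃F F ∣ ≤ ∣ X ∣ ∸ r
  room = begin
    2 * d ∸ ∣ ⋃F F ∣      ≤⟨ ∸-monoʳ-≤ (2 * d) (1≤∣⋃F∣ F 1≤size) ⟩
    2 * d ∸ 1             ≡⟨ [m+n]∸[m+o]≡n∸o r (2 * d) 1 ⟨
    r + 2 * d ∸ (r + 1)   ≡⟨ cong (r + 2 * d ∸_) (+-comm r 1) ⟩
    r + 2 * d ∸ (1 + r)   ≡⟨ ∸-+-assoc (r + 2 * d) 1 r ⟨
    r + 2 * d ∸ 1 ∸ r     ≡⟨ cong (_∸ r) ∣X∣ ⟨
    ∣ X ∣ ∸ r             ∎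
    where open ≤-Reasoning

DecodingInvariant : ℕ → {A : Set} → (Fam n → A) → Subset n → Set
DecodingInvariant d λ′ X = ∀ Y₁ Y₂ → ∣ Y₁ ∣ ≡ 2 * d → ∣ Y₂ ∣ ≡ 2 * d → Y₁ ⊆ X → Y₂ ⊆ X →
  ∀ β → λ′ (decodeFamily Y₁ β) ≡ λ′ (decodeFamily Y₂ β)

canonical-takeFirst : {d r : ℕ} {A : Set} (λ′ : Fam n → A) (X : Subset n) →
  ∣ X ∣ ≡ r + 2 * d ∸ 1 → DecodingInvariant d λ′ X → Canonical d λ′ (takeFirst r X)
canonical-takeFirst {d = d} {r} λ′ X ∣X∣ invariant F₁ F₂ fam₁ fam₂ in₁ in₂ same =
  sameValue (decodingSet {d = d} {r} {X} {F₁} ∣X∣ fam₁ in₁)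
            (decodingSet {d = d} {r} {X} {F₂} ∣X∣ fam₂ in₂)
  where
  open ≡-Reasoning
  samePattern : ∀ p → typePattern F₁ p ≡ typePattern F₂ p
  samePattern = sameType⇒typePattern {F = F₁} {F₂} same
  sameValue : ∃ (IsDecodingSet d X F₁) → ∃ (IsDecodingSet d X F₂) → λ′ F₁ ≡ λ′ F₂
  sameValue (Y₁ , ∣Y₁∣ , Y₁⊆X , decode₁) (Y₂ , ∣Y₂∣ , Y₂⊆X , decode₂) = begin
    λ′ F₁                                   ≡⟨ cong λ′ decode₁ ⟨
    λ′ (decodeFamily Y₁ (typePattern F₁))   ≡⟨ cong λ′ (decodeFamily-cong Y₁ λ {p} _ → samePattern p) ⟩
    λ′ (decodeFamily Y₁ (typePattern F₂))   ≡⟨ invariant Y₁ Y₂ ∣Y₁∣ ∣Y₂∣ Y₁⊆X Y₂⊆X (typePattern F₂) ⟩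
    λ′ (decodeFamily Y₂ (typePattern F₂))   ≡⟨ cong λ′ decode₂ ⟩
    λ′ F₂                                   ∎

encodePattern : ∀ N → (ℕ → Bool) → Fin (2 ^ N)
encodePattern N β = funToFin {N} (Inverse.from 2↔Bool ∘ β ∘ toℕ)

-- bits at positions ≥ N are reported as unset
decodePattern : ∀ N → Fin (2 ^ N) → ℕ → Bool
decodePattern N c p with p <? N
... | yes p<N = Inverse.to 2↔Bool (finToFun c (fromℕ< p<N))
... | no _ = false

decodePattern-encodePattern : ∀ N (β : ℕ → Bool) {p} → p < N →
  decodePattern N (encodePattern N β) p ≡ β p
decodePattern-encodePattern N β {p} p<N with p <? N
... | no p≮N = contradiction p<N p≮N
... | yes p<N′ = begin
  Inverse.to 2↔Bool (finToFun (encodePattern N β) (fromℕ< p<N′))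
    ≡⟨ cong (Inverse.to 2↔Bool) (finToFun-funToFin _ (fromℕ< p<N′)) ⟩
  Inverse.to 2↔Bool (Inverse.from 2↔Bool (β (toℕ (fromℕ< p<N′))))
    ≡⟨ Inverse.strictlyInverseˡ 2↔Bool _ ⟩
  β (toℕ (fromℕ< p<N′))
    ≡⟨ cong β (toℕ-fromℕ< p<N′) ⟩
  β p ∎
  where open ≡-Reasoning

encodeTable : ∀ N k → (Fin (2 ^ N) → Fin (2 ^ k)) → Fin (2 ^ (k * 2 ^ N))
encodeTable N k g = cast (^-*-assoc 2 k (2 ^ N)) (funToFin g)

encodeTable-injective : ∀ N k {g h : Fin (2 ^ N) → Fin (2 ^ k)} →
  encodeTable N k g ≡ encodeTable N k h → ∀ c → g c ≡ h c
encodeTable-injective N k {g} {h} eq c = begin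
  g c                       ≡⟨ finToFun-funToFin g c ⟨
  finToFun (funToFin g) c   ≡⟨ cong (λ e → finToFun e c) funToFin-g≡funToFin-h ⟩
  finToFun (funToFin h) c   ≡⟨ finToFun-funToFin h c ⟩
  h c                       ∎
  where
  open ≡-Reasoning
  cast-eq = ^-*-assoc 2 k (2 ^ N)
  funToFin-g≡funToFin-h : funToFin g ≡ funToFin h
  funToFin-g≡funToFin-h = toℕ-injective (begin
    toℕ (funToFin g)          ≡⟨ toℕ-cast cast-eq (funToFin g) ⟨
    toℕ (encodeTable N k g)   ≡⟨ cong toℕ eq ⟩
    toℕ (encodeTable N k h)   ≡⟨ toℕ-cast cast-eq (funToFin h) ⟩
    toℕ (funToFin h)          ∎)

colouring : ∀ d k → (Fam n → Fin (2 ^ k)) → Colouring n (2 * d) (2 ^ (k * 2 ^ (2 * d * d + d)))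
colouring d k λ′ Y _ =
  encodeTable (2 * d * d + d) k λ c → λ′ (decodeFamily Y (decodePattern (2 * d * d + d) c))

monochromatic⇒decodingInvariant : ∀ d k (λ′ : Fam n → Fin (2 ^ k)) {X : Subset n} →
  MonochromaticIn (colouring d k λ′) X → DecodingInvariant d λ′ X
monochromatic⇒decodingInvariant d k λ′ monochromatic Y₁ Y₂ ∣Y₁∣ ∣Y₂∣ Y₁⊆X Y₂⊆X β = begin
  λ′ (decodeFamily Y₁ β)                          ≡⟨ cong λ′ (truncate ∣Y₁∣) ⟩
  λ′ (decodeFamily Y₁ (decodePattern N code))     ≡⟨ encodeTable-injective N k same-colour code ⟩
  λ′ (decodeFamily Y₂ (decodePattern N code))     ≡⟨ cong λ′ (truncate ∣Y₂∣) ⟨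
  λ′ (decodeFamily Y₂ β)                          ∎
  where
  open ≡-Reasoning
  N = 2 * d * d + d
  code = encodePattern N β
  same-colour = monochromatic Y₁ Y₂ ∣Y₁∣ ∣Y₂∣ Y₁⊆X Y₂⊆X
  truncate : ∀ {Y} → ∣ Y ∣ ≡ 2 * d → decodeFamily Y β ≡ decodeFamily Y (decodePattern N code)
  truncate {Y} ∣Y∣ = decodeFamily-cong Y λ p< →
    sym (decodePattern-encodePattern N β (subst (_ <_) (trans (cong triangle ∣Y∣) (triangle[2d] d)) p<))

corollary5p9 : (n d r k : ℕ) → 1 ≤ n → 1 ≤ d → 1 ≤ r → 1 ≤ k →
    (R : ℕ) → IsRamseyNumber (2 * d) (r + 2 * d ∸ 1) (2 ^ (k * 2 ^ (2 * d * d + d))) R →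
    R ≤ n →
    (λ' : Fam n → Fin (2 ^ k)) →
    ∃[ X ] (∣ X ∣ ≡ r × Canonical d λ' X)
corollary5p9 n d r k _ 1≤d _ _ R (_ , ramsey , _) R≤n λ′
  with ramsey n R≤n (colouring d k λ′)
... | X , ∣X∣ , monochromatic =
  takeFirst r X , ∣takeFirst∣ r X r≤∣X∣ ,
  canonical-takeFirst λ′ X ∣X∣ (monochromatic⇒decodingInvariant d k λ′ monochromatic)
  where
  r≤∣X∣ : r ≤ ∣ X ∣
  r≤∣X∣ = subst (r ≤_) (trans (sym (+-∸-assoc r (*-mono-≤ {1} {2} (s≤s z≤n) 1≤d))) (sym ∣X∣)) (m≤m+n r _)
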